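{- Let $G=(V,E)$ be a graph, $k$ a nonnegative integer, and $M_0$ a maximal matching of $G$ with $m=|M_0|$. Let $V_m=V(M_0)$ be the set of endpoints of edges of $M_0$ and $V^*=V\setminus V_m$. For $v\in V_m$ let $x_v=|V^*\cap N(v)|$, and call $v$ overloaded if $m+x_v>2k$; let $A\subseteq V_m$ be the set of overloaded vertices. Then every edge dominating set $M$ of $G$ with $|M|\le k$ satisfies $A\subseteq V(M)$.
   Context: An edge dominating set of $G$ is a subset $M\subseteq E$ such that every edge in $E\setminus M$ shares at least one endpoint with some edge of $M$. For a set of edges $M$, $V(M)$ denotes the set of all endpoints of edges in $M$. $N(v)$ is the set of neighbors of $v$. -}

module Defs where

open import Data.Nat using (ℕ; suc; _+_; _*_; _≤_; _<_)
open import Data.Fin using (Fin)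
open import Data.Fin.Properties using (_≟_)
open import Data.Product using (_×_; _,_; proj₁; proj₂; ∃; ∃-syntax)
open import Data.Sum using (_⊎_)
open import Data.List using (List; length; filter)
open import Data.List.Membership.Propositional using (_∈_)
open import Data.List.Relation.Unary.Any using (any?)
open import Data.List.Relation.Unary.All using (All)
open import Data.List.Relation.Unary.AllPairs using (AllPairs)
open import Relation.Binary.PropositionalEquality using (_≡_)
open import Relation.Nullary using (¬_; Dec)
open import Relation.Nullary.Decidable using (_⊎-dec_; ¬?)
open import Relation.Unary using (Pred)
open import Data.Vec.Functional using ()
open import Data.List using (allFin)

record Graph (n : ℕ) : Set₁ where
  field
    Adj      : Fin n → Fin n → Set
    adj?     : (u v : Fin n) → Dec (Adj u v)
    sym      : ∀ {u v} → Adj u v → Adj v u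
    irrefl   : ∀ {u} → ¬ Adj u u

module _ {n : ℕ} (G : Graph n) where
  open Graph G

  -- an edge is represented by an ordered pair of its endpoints
  Edge : Set
  Edge = Fin n × Fin n

  _isEndOf_ : Fin n → Edge → Set
  v isEndOf (a , b) = v ≡ a ⊎ v ≡ b

  -- two pairs represent the same (unordered) edge
  SameEdge : Edge → Edge → Set
  SameEdge (a , b) (c , d) = (a ≡ c × b ≡ d) ⊎ (a ≡ d × b ≡ c)

  ShareEnd : Edge → Edge → Set
  ShareEnd e f = ∃[ v ] (v isEndOf e × v isEndOf f)

  -- A set of edges of G: a list of edges of G, no edge listed twice.
  -- Its cardinality is the length of the list.
  record EdgeSet (M : List Edge) : Set where
    field
      edges    : All (λ e → Adj (proj₁ e) (proj₂ e)) M
      distinct : AllPairs (λ e f → ¬ SameEdge e f) M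

  _∈V_ : Fin n → List Edge → Set
  v ∈V M = ∃[ e ] (e ∈ M × v isEndOf e)

  _∈V?_ : (v : Fin n) → (M : List Edge) → Dec (∃[ e ] (e ∈ M × v isEndOf e))
  v ∈V? M = Relation.Nullary.Decidable.map′ to from (any? (λ e → (v ≟ proj₁ e) ⊎-dec (v ≟ proj₂ e)) M)
    where
    open import Data.List.Membership.Propositional using (find; lose)
    open import Function using (_∘_)
    to : _ → ∃[ e ] (e ∈ M × v isEndOf e)
    to a with find a
    ... | e , e∈ , p = e , e∈ , p
    from : ∃[ e ] (e ∈ M × v isEndOf e) → _
    from (e , e∈ , p) = lose e∈ p

  IsMatching : List Edge → Set
  IsMatching M = EdgeSet M × AllPairs (λ e f → ¬ ShareEnd e f) M

  -- maximal matching: a matching such that every edge of G shares an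
  -- endpoint with some edge of M (so no edge can be added)
  IsMaximalMatching : List Edge → Set
  IsMaximalMatching M = IsMatching M ×
    (∀ u v → Adj u v → ∃[ e ] (e ∈ M × ShareEnd (u , v) e))

  IsEdgeDominatingSet : List Edge → Set
  IsEdgeDominatingSet M = EdgeSet M ×
    (∀ u v → Adj u v → ¬ (∃[ e ] (e ∈ M × SameEdge (u , v) e)) →
       ∃[ e ] (e ∈ M × ShareEnd (u , v) e))

  xval : List Edge → Fin n → ℕ
  xval M₀ v = length (filter (λ w → adj? v w Relation.Nullary.Decidable.×-dec ¬? (w ∈V? M₀)) (allFin n))

  Overloaded : List Edge → ℕ → Fin n → Set
  Overloaded M₀ k v = v ∈V M₀ × 2 * k < length M₀ + xval M₀ v

-- Suppose v ∉ V(M). Every edge at v must then be dominated through its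
-- other endpoint, so all x_v free neighbours of v lie in V(M). Every edge
-- of M₀ is dominated as well, so each of the m disjoint edges of M₀ has an
-- endpoint in V(M). These m + x_v vertices are pairwise distinct, whereas
-- |V(M)| ≤ 2|M| ≤ 2k, contradicting m + x_v > 2k.
module Submission where

open import Defs
open import Data.Nat using (ℕ; _≤_)
open import Data.List using (List; length)

open import Data.Nat using (_+_; _*_)
open import Data.Nat.Properties using (<⇒≱; *-suc; *-monoʳ-≤; module ≤-Reasoning)
open import Data.Fin using (Fin; zero; suc)
open import Data.Fin.Properties using (injective⇒≤)
open import Data.List using ([]; _∷_; map; filter; _++_; allFin; lookup)
open import Data.List.Properties using (length-map; length-++)
open import Data.List.Membership.Propositional using (_∈_)
open import Data.List.Membership.Propositional.Properties using (∈-lookup; ∈-filter⁻; ∈-map⁻; ∈-++⁻)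
open import Data.List.Membership.Setoid.Properties using (index-injective)
open import Data.List.Relation.Binary.Subset.Propositional using (_⊆_)
open import Data.List.Relation.Unary.Any using (here; there)
open import Data.List.Relation.Unary.All as All using ()
open import Data.List.Relation.Unary.AllPairs as AllPairs using (_∷_)
open import Data.List.Relation.Unary.AllPairs.Properties as AllPairsₚ using ()
open import Data.List.Relation.Unary.Unique.Propositional using (Unique)
import Data.List.Relation.Unary.Unique.Propositional.Properties as Uniqueₚ
open import Data.Product using (_×_; _,_; proj₁; proj₂; ∃-syntax)
open import Data.Sum using (inj₁; inj₂)
open import Data.Empty using (⊥-elim)
open import Function using (_∘_)
open import Relation.Nullary using (¬_; yes; no)
open import Relation.Nullary.Decidable using (_×-dec_; ¬?)
open import Relation.Unary using (Decidable)
open import Relation.Binary.PropositionalEquality using (_≡_; _≢_; refl; sym; trans; cong; subst; setoid)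

module _ {A : Set} where

  lookup-injective : ∀ {xs : List A} → Unique xs → ∀ {i j} →
                     lookup xs i ≡ lookup xs j → i ≡ j
  lookup-injective (_   ∷ _) {zero}  {zero}  _  = refl
  lookup-injective (x∉ ∷ _) {zero}  {suc j} eq = ⊥-elim (All.lookup x∉ (∈-lookup j) eq)
  lookup-injective (x∉ ∷ _) {suc i} {zero}  eq = ⊥-elim (All.lookup x∉ (∈-lookup i) (sym eq))
  lookup-injective (_  ∷ u) {suc i} {suc j} eq = cong suc (lookup-injective u eq)

  Unique-⊆⇒length≤ : ∀ {xs ys : List A} → Unique xs → xs ⊆ ys → length xs ≤ length ys
  Unique-⊆⇒length≤ u xs⊆ys = injective⇒≤ λ {i} {j} eq →
    lookup-injective u (index-injective (setoid A) (xs⊆ys (∈-lookup i)) (xs⊆ys (∈-lookup j)) eq)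

module _ {n : ℕ} (G : Graph n) where
  open Graph G using (Adj; adj?)

  ends : List (Edge G) → List (Fin n)
  ends []            = []
  ends ((a , b) ∷ M) = a ∷ b ∷ ends M

  length-ends : ∀ M → length (ends M) ≡ 2 * length M
  length-ends []            = refl
  length-ends ((a , b) ∷ M) = trans (cong (2 +_) (length-ends M)) (sym (*-suc 2 (length M)))

  ∈V⇒∈ends : ∀ {w} M → _∈V_ G w M → w ∈ ends M
  ∈V⇒∈ends (_ ∷ M) (_ , here refl , inj₁ refl) = here refl
  ∈V⇒∈ends (_ ∷ M) (_ , here refl , inj₂ refl) = there (here refl)
  ∈V⇒∈ends (_ ∷ M) (e , there e∈M , w∈e)       = there (there (∈V⇒∈ends M (e , e∈M , w∈e)))

  Unique-⊆V⇒length≤ : ∀ {ws} M → Unique ws → (∀ {w} → w ∈ ws → _∈V_ G w M) →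
                      length ws ≤ 2 * length M
  Unique-⊆V⇒length≤ M u ws⊆V =
    subst (_ ≤_) (length-ends M) (Unique-⊆⇒length≤ u (∈V⇒∈ends M ∘ ws⊆V))

  freeNeighbour? : (M₀ : List (Edge G)) (v : Fin n) → Decidable (λ w → Adj v w × ¬ _∈V_ G w M₀)
  freeNeighbour? M₀ v w = adj? v w ×-dec ¬? (_∈V?_ G w M₀)

  freeNeighbours : List (Edge G) → Fin n → List (Fin n)
  freeNeighbours M₀ v = filter (freeNeighbour? M₀ v) (allFin n)

  ∈freeNeighbours⁻ : ∀ {M₀ v w} → w ∈ freeNeighbours M₀ v → Adj v w × ¬ _∈V_ G w M₀
  ∈freeNeighbours⁻ {M₀} {v} = proj₂ ∘ ∈-filter⁻ (freeNeighbour? M₀ v) {xs = allFin n}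

  freeNeighbours-unique : ∀ M₀ v → Unique (freeNeighbours M₀ v)
  freeNeighbours-unique M₀ v =
    Uniqueₚ.filter⁺ (freeNeighbour? M₀ v) (Uniqueₚ.allFin⁺ n)

  module Dominated {M : List (Edge G)} (dom : IsEdgeDominatingSet G M) where

    ∉V⇒¬∈M : ∀ {a} b → ¬ _∈V_ G a M → ¬ (∃[ e ] (e ∈ M × SameEdge G (a , b) e))
    ∉V⇒¬∈M b a∉V (e , e∈M , inj₁ (refl , _)) = a∉V (e , e∈M , inj₁ refl)
    ∉V⇒¬∈M b a∉V (e , e∈M , inj₂ (refl , _)) = a∉V (e , e∈M , inj₂ refl)

    neighbour-∈V : ∀ {a b} → Adj a b → ¬ _∈V_ G a M → _∈V_ G b M
    neighbour-∈V {a} {b} ab a∉V with proj₂ dom a b ab (∉V⇒¬∈M b a∉V)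
    ... | e , e∈M , _ , inj₁ refl , a∈e = ⊥-elim (a∉V (e , e∈M , a∈e))
    ... | e , e∈M , _ , inj₂ refl , b∈e = e , e∈M , b∈e

    coveredEnd : Edge G → Fin n
    coveredEnd (a , b) with _∈V?_ G a M
    ... | yes _ = a
    ... | no  _ = b

    coveredEnd-isEnd : ∀ e → _isEndOf_ G (coveredEnd e) e
    coveredEnd-isEnd (a , b) with _∈V?_ G a M
    ... | yes _ = inj₁ refl
    ... | no  _ = inj₂ refl

    coveredEnd-∈V : ∀ {a b} → Adj a b → _∈V_ G (coveredEnd (a , b)) M
    coveredEnd-∈V {a} ab with _∈V?_ G a M
    ... | yes a∈V = a∈V
    ... | no  a∉V = neighbour-∈V ab a∉V

  module _ {M₀ : List (Edge G)} (matching : IsMatching G M₀)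
           {M : List (Edge G)} (dom : IsEdgeDominatingSet G M) where
    open Dominated dom

    witnesses : Fin n → List (Fin n)
    witnesses v = map coveredEnd M₀ ++ freeNeighbours M₀ v

    length-witnesses : ∀ v → length (witnesses v) ≡ length M₀ + xval G M₀ v
    length-witnesses v =
      trans (length-++ (map coveredEnd M₀)) (cong (_+ xval G M₀ v) (length-map coveredEnd M₀))

    coveredEnds-∈V₀ : ∀ {w} → w ∈ map coveredEnd M₀ → _∈V_ G w M₀
    coveredEnds-∈V₀ w∈ with ∈-map⁻ coveredEnd w∈
    ... | e , e∈M₀ , refl = e , e∈M₀ , coveredEnd-isEnd e

    coveredEnds-∈V : ∀ {w} → w ∈ map coveredEnd M₀ → _∈V_ G w M
    coveredEnds-∈V w∈ with ∈-map⁻ coveredEnd w∈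
    ... | e , e∈M₀ , refl = coveredEnd-∈V (All.lookup (EdgeSet.edges (proj₁ matching)) e∈M₀)

    coveredEnds-unique : Unique (map coveredEnd M₀)
    coveredEnds-unique = AllPairsₚ.map⁺ (AllPairs.map disjoint⇒≢ (proj₂ matching))
      where
      disjoint⇒≢ : ∀ {e f} → ¬ ShareEnd G e f → coveredEnd e ≢ coveredEnd f
      disjoint⇒≢ {e} {f} e∩f=∅ eq =
        e∩f=∅ (coveredEnd e , coveredEnd-isEnd e , subst (λ w → _isEndOf_ G w f) (sym eq) (coveredEnd-isEnd f))

    witnesses-unique : ∀ v → Unique (witnesses v)
    witnesses-unique v = AllPairsₚ.++⁺ coveredEnds-unique (freeNeighbours-unique M₀ v)
      (All.tabulate λ w∈ → All.tabulate λ u∈ w≡u →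
        proj₂ (∈freeNeighbours⁻ u∈) (subst (λ w → _∈V_ G w M₀) w≡u (coveredEnds-∈V₀ w∈)))

    witnesses-∈V : ∀ {v} → ¬ _∈V_ G v M → ∀ {w} → w ∈ witnesses v → _∈V_ G w M
    witnesses-∈V {v} v∉V w∈ with ∈-++⁻ (map coveredEnd M₀) w∈
    ... | inj₁ w∈covered = coveredEnds-∈V w∈covered
    ... | inj₂ w∈free = neighbour-∈V (proj₁ (∈freeNeighbours⁻ w∈free)) v∉V

lemma8 : ∀ {n} (G : Graph n) (k : ℕ) (M₀ : List (Edge G)) →
    IsMaximalMatching G M₀ →
    ∀ (M : List (Edge G)) → IsEdgeDominatingSet G M → length M ≤ k →
    ∀ v → Overloaded G M₀ k v → _∈V_ G v M
lemma8 G k M₀ (matching , _) M dom |M|≤k v (_ , overloaded) with _∈V?_ G v M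
... | yes v∈V = v∈V
... | no  v∉V = ⊥-elim (<⇒≱ overloaded (begin
  length M₀ + xval G M₀ v  ≡⟨ length-witnesses G matching dom v ⟨
  length (witnesses G matching dom v)
    ≤⟨ Unique-⊆V⇒length≤ G M (witnesses-unique G matching dom v) (witnesses-∈V G matching dom v∉V) ⟩
  2 * length M             ≤⟨ *-monoʳ-≤ 2 |M|≤k ⟩
  2 * k                    ∎))
  where open ≤-Reasoning
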